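{- Let $S[0\ldots n-1]$ be a list of $n$ elements, each carrying an integer key, with all keys pairwise distinct and lying in some range $[u,v]$. Let $\delta=\min(S)$ be the minimum key and let $n_d$ be the number of elements whose key lies in $[\delta,\delta+n-1]$. Then there is an algorithm which, using only $\mathcal{O}(1)$ extra space (a constant number of additional words) and never modifying the keys (the list is changed only by swapping elements), rearranges $S$ so that the $n_d$ elements with keys in $[\delta,\delta+n-1]$ occupy positions $S[0\ldots n_d-1]$ in increasing order of their keys. The algorithm runs in $\mathcal{O}(n)$ time and performs at least $0$ and at most $2n_d-1$ swaps.
   Context: Model: word RAM with fixed word length $w$; integer keys are in the universe $[0,2^w-1]$, each stored in one word. The keys are read-only: the algorithm may read keys, compare them, do arithmetic on copies, and swap whole elements (key together with any satellite data) within the list, but may not overwrite a key with a different value. Extra space means memory beyond the input list. -}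

module Defs where

open import Data.Nat using (ℕ; zero; suc; _+_; _*_; _∸_; _^_; _≤_; _<_; _⊓_; _%_)
open import Data.Nat.Properties using (_<?_; _≤?_; m^n≢0)
open import Data.Fin using (Fin; fromℕ<)
open import Data.Vec using (Vec; lookup; _[_]≔_; foldr₁; map; count)
open import Data.Maybe using (Maybe; just; nothing)
open import Data.Product using (_×_)
open import Relation.Nullary using (yes; no)
open import Relation.Nullary.Decidable using (_×-dec_)

-- A minimal word-RAM model with a read-only-key list that may only be
-- permuted by swaps, plus a constant number k of word registers
-- (this is the "O(1) extra space").  The list holds elements of an
-- arbitrary type A (key + satellite data); the program can observe an
-- element only through its key.

Reg : ℕ → Set
Reg k = Fin k

data Instr (k : ℕ) : Set where
  const  : Reg k → ℕ → Instr k
  lastIx : Reg k → Instr k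
  add    : Reg k → Reg k → Reg k → Instr k
  sub    : Reg k → Reg k → Reg k → Instr k
  mul    : Reg k → Reg k → Reg k → Instr k
  key    : Reg k → Reg k → Instr k
  swap   : Reg k → Reg k → Instr k
  jlt    : Reg k → Reg k → ℕ → Instr k
  jmp    : ℕ → Instr k
  halt   : Instr k

record State (k : ℕ) (A : Set) (n : ℕ) : Set where
  constructor st
  field
    pc    : ℕ
    regs  : Vec ℕ k
    list  : Vec A n
    swaps : ℕ
open State public

data Outcome (k : ℕ) (A : Set) (n : ℕ) : Set where
  halted : State k A n → Outcome k A n
  fault  : Outcome k A n
  next   : State k A n → Outcome k A n

module _ (w : ℕ) {k m : ℕ} (P : Vec (Instr k) m)
         {A : Set} (keyOf : A → ℕ) {n : ℕ} where

  trunc : ℕ → ℕ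
  trunc x = _%_ x (2 ^ w) {{m^n≢0 2 w}}

  private
    set : Vec ℕ k → Reg k → ℕ → Vec ℕ k
    set rs r v = rs [ r ]≔ trunc v

  exec : Instr k → State k A n → Outcome k A n
  exec (const r c) (st p rs l s) = next (st (suc p) (set rs r c) l s)
  exec (lastIx r) (st p rs l s) = next (st (suc p) (set rs r (n ∸ 1)) l s)
  exec (add r a b) (st p rs l s) =
    next (st (suc p) (set rs r (lookup rs a + lookup rs b)) l s)
  exec (sub r a b) (st p rs l s) =
    next (st (suc p) (set rs r (lookup rs a ∸ lookup rs b)) l s)
  exec (mul r a b) (st p rs l s) =
    next (st (suc p) (set rs r (lookup rs a * lookup rs b)) l s)
  exec (key r a) (st p rs l s) with lookup rs a <? n
  ... | yes i<n = next (st (suc p) (set rs r (keyOf (lookup l (fromℕ< i<n)))) l s)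
  ... | no _ = fault
  exec (swap a b) (st p rs l s) with lookup rs a <? n | lookup rs b <? n
  ... | yes i<n | yes j<n =
        let i = fromℕ< i<n ; j = fromℕ< j<n in
        next (st (suc p) rs ((l [ i ]≔ lookup l j) [ j ]≔ lookup l i) (suc s))
  ... | _ | _ = fault
  exec (jlt a b t) (st p rs l s) with lookup rs a <? lookup rs b
  ... | yes _ = next (st t rs l s)
  ... | no _ = next (st (suc p) rs l s)
  exec (jmp t) (st p rs l s) = next (st t rs l s)
  exec halt σ = halted σ

  -- one step; running off the end of the program counts as halting
  step : State k A n → Outcome k A n
  step σ with pc σ <? m
  ... | yes p<m = exec (lookup P (fromℕ< p<m)) σ
  ... | no _ = halted σ

  run : ℕ → State k A n → Maybe (State k A n)
  run zero σ with step σ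
  ... | halted σ' = just σ'
  ... | _ = nothing
  run (suc t) σ with step σ
  ... | halted σ' = just σ'
  ... | fault = nothing
  ... | next σ' = run t σ'

  initial : Vec A n → State k A n
  initial S = st 0 (Data.Vec.replicate k 0) S 0

minKey : {A : Set} → (A → ℕ) → {n : ℕ} → Vec A (suc n) → ℕ
minKey keyOf S = foldr₁ _⊓_ (map keyOf S)

-- n_d = number of elements with key in [δ, δ + n - 1]  (n = suc n')
nd : {A : Set} → (A → ℕ) → {n : ℕ} → Vec A (suc n) → ℕ
nd keyOf {n} S =
  count (λ x → (minKey keyOf S ≤? keyOf x) ×-dec (keyOf x ≤? minKey keyOf S + n)) S

module Submission where

-- The machine first finds δ by a linear scan.  It then walks through the
-- positions i and, while the key at i is δ + h with h ≤ n and h ≠ i, swaps it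
-- to its home position h.  Keys are distinct, so position h did not hold its
-- home key before; every swap therefore adds an element at home, which bounds
-- the swaps of this phase by the number of keys in [δ, δ + n], i.e. by n_d, and
-- its running time by O(n).  Afterwards every position holds its home key or a
-- key above δ + n, and a final scan moves the elements at home to the front
-- in order.  The first of them is δ, already at position 0, so this scan needs
-- at most n_d − 1 swaps.

open import Defs
open import Data.Fin as Fin using (Fin; toℕ; fromℕ<; zero; suc)
open import Data.Fin.Permutation as Perm using (Permutation′; _⟨$⟩ʳ_; _⟨$⟩ˡ_; _∘ₚ_; inverseˡ; inverseʳ)
import Data.Fin.Permutation.Components as PC
open import Data.Fin.Properties using (toℕ<n; toℕ-fromℕ<; toℕ-injective)
open import Data.Fin.Subset using (Subset; _∈_; _⊆_; _⊂_; ∣_∣)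
open import Data.Fin.Subset.Properties using (p⊂q⇒∣p∣<∣q∣; p⊆q⇒∣p∣≤∣q∣; ∣p∣≤n)
open import Data.Maybe using (just)
open import Data.Nat using (ℕ; zero; suc; _+_; _*_; _∸_; _^_; _≤_; _<_; _⊓_; _≟_; _<?_; _≤?_; z≤n; s≤s; s≤s⁻¹)
open import Data.Nat.DivMod using (m<n⇒m%n≡m)
open import Data.Nat.Properties
open import Algebra.Properties.CommutativeMonoid.Sum +-0-commutativeMonoid using (sum; sum-cong-≗; sum-permute)
open import Data.Nat.Tactic.RingSolver using (solve-∀)
open import Data.Product using (Σ; ∃; ∃₂; _×_; _,_; proj₁; proj₂)
open import Data.Sum using (_⊎_; inj₁; inj₂)
open import Data.Vec using (Vec; []; _∷_; lookup; tabulate; map; count; foldr₁; _[_]≔_)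
open import Data.Vec.Properties using (lookup∘update; lookup∘update′; lookup∘tabulate; lookup-map; []=⇒lookup; lookup⇒[]=)
open import Function using (_∘_)
open import Relation.Binary.PropositionalEquality using (_≡_; _≢_; refl; sym; trans; cong; subst; subst₂)
open import Relation.Nullary using (Dec; yes; no; ¬_; does; contradiction)
open import Relation.Nullary.Decidable using (dec-true; _×-dec_)
open import Relation.Unary using (Pred; Decidable)

private variable
  A : Set
  m : ℕ

swapElems : Vec A m → Fin m → Fin m → Vec A m
swapElems l a b = (l [ a ]≔ lookup l b) [ b ]≔ lookup l a

module _ (l : Vec A m) (a b : Fin m) where

  lookup-swapElems-ʳ : lookup (swapElems l a b) b ≡ lookup l a
  lookup-swapElems-ʳ = lookup∘update b (l [ a ]≔ lookup l b) (lookup l a)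

  lookup-swapElems-ˡ : a ≢ b → lookup (swapElems l a b) a ≡ lookup l b
  lookup-swapElems-ˡ a≢b =
    trans (lookup∘update′ a≢b (l [ a ]≔ lookup l b) (lookup l a)) (lookup∘update a l (lookup l b))

  lookup-swapElems-other : ∀ {q} → q ≢ a → q ≢ b → lookup (swapElems l a b) q ≡ lookup l q
  lookup-swapElems-other q≢a q≢b =
    trans (lookup∘update′ q≢b (l [ a ]≔ lookup l b) (lookup l a)) (lookup∘update′ q≢a l (lookup l b))

  lookup-swapElems : ∀ q → lookup (swapElems l a b) q ≡ lookup l (PC.transpose a b q)
  lookup-swapElems q with q Fin.≟ a
  ... | yes refl with q Fin.≟ b
  ...   | yes refl = lookup-swapElems-ʳ
  ...   | no q≢b   = lookup-swapElems-ˡ q≢b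
  lookup-swapElems q | no q≢a with q Fin.≟ b
  ...   | yes refl = lookup-swapElems-ʳ
  ...   | no q≢b   = lookup-swapElems-other q≢a q≢b

foldr₁-⊓-≤ : ∀ (v : Vec ℕ (suc m)) q → foldr₁ _⊓_ v ≤ lookup v q
foldr₁-⊓-≤ (x ∷ [])     zero    = ≤-refl
foldr₁-⊓-≤ (x ∷ y ∷ ys) zero    = m⊓n≤m x _
foldr₁-⊓-≤ (x ∷ y ∷ ys) (suc q) = ≤-trans (m⊓n≤n x _) (foldr₁-⊓-≤ (y ∷ ys) q)

foldr₁-⊓-sel : ∀ (v : Vec ℕ (suc m)) → ∃ λ q → foldr₁ _⊓_ v ≡ lookup v q
foldr₁-⊓-sel (x ∷ [])     = zero , refl
foldr₁-⊓-sel (x ∷ y ∷ ys) with ⊓-sel x (foldr₁ _⊓_ (y ∷ ys))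
... | inj₁ e = zero , e
... | inj₂ e with foldr₁-⊓-sel (y ∷ ys)
...   | q , e′ = suc q , trans e e′

module _ {p} {P : Pred (Fin m) p} (P? : Decidable P) where

  ∈-tabulate⁺ : ∀ {q} → P q → q ∈ tabulate (does ∘ P?)
  ∈-tabulate⁺ {q} Pq = lookup⇒[]= q _ (trans (lookup∘tabulate (does ∘ P?) q) (dec-true (P? q) Pq))

  ∈-tabulate⁻ : ∀ {q} → q ∈ tabulate (does ∘ P?) → P q
  ∈-tabulate⁻ {q} q∈ with P? q | trans (sym (lookup∘tabulate (does ∘ P?) q)) ([]=⇒lookup q∈)
  ... | yes Pq | _  = Pq
  ... | no _   | ()

indicator : ∀ {p} {X : Set p} → Dec X → ℕ
indicator (yes _) = 1
indicator (no _)  = 0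

module _ {p} {P : Pred A p} (P? : Decidable P) where

  count≡sum : (v : Vec A m) → count P? v ≡ sum (λ q → indicator (P? (lookup v q)))
  count≡sum []       = refl
  count≡sum (x ∷ xs) with P? x
  ... | yes _ = cong suc (count≡sum xs)
  ... | no _  = count≡sum xs

  count-permute : ∀ (u v : Vec A m) (π : Permutation′ m) → (∀ q → lookup u q ≡ lookup v (π ⟨$⟩ʳ q)) →
                  count P? u ≡ count P? v
  count-permute u v π u≗v∘π = trans (count≡sum u) (trans
    (sum-cong-≗ (λ q → cong (indicator ∘ P?) (u≗v∘π q)))
    (trans (sym (sum-permute _ π)) (sym (count≡sum v))))

  ∣tabulate∣≡count : (v : Vec A m) → ∣ tabulate (does ∘ P? ∘ lookup v) ∣ ≡ count P? v
  ∣tabulate∣≡count []       = refl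
  ∣tabulate∣≡count (x ∷ xs) with P? x
  ... | yes _ = cong suc (∣tabulate∣≡count xs)
  ... | no _  = ∣tabulate∣≡count xs

  count-prefix : ∀ (v : Vec A m) k → k ≤ m →
                 (∀ q → P (lookup v q) → toℕ q < k) → (∀ q → toℕ q < k → P (lookup v q)) → count P? v ≡ k
  count-prefix []       zero    _         _   _  = refl
  count-prefix (x ∷ xs) zero    _         out _  with P? x
  ... | yes Px = contradiction (out zero Px) n≮0
  ... | no _   = count-prefix xs zero z≤n (λ q Pq → contradiction (out (suc q) Pq) n≮0) λ _ ()
  count-prefix (x ∷ xs) (suc k) (s≤s k≤m) out in′ with P? x
  ... | yes _  = cong suc (count-prefix xs k k≤m (λ q → s≤s⁻¹ ∘ out (suc q)) (λ q → in′ (suc q) ∘ s≤s))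
  ... | no ¬Px = contradiction (in′ zero (s≤s z≤n)) ¬Px

extend-upTo : ∀ {i} {P : Fin m → Set} (i<m : i < m) → (∀ q → toℕ q < i → P q) → P (fromℕ< i<m) →
              ∀ q → toℕ q ≤ i → P q
extend-upTo {i = i} {P} i<m below at q q≤i with toℕ q ≟ i
... | yes q≡i = subst P (sym (toℕ-injective (trans q≡i (sym (toℕ-fromℕ< i<m))))) at
... | no q≢i  = below q (≤∧≢⇒< q≤i q≢i)

amortised-++ : ∀ c₁ c₂ {t₁ t₂ a b e} → t₁ + a ≤ c₁ + b → t₂ + b ≤ c₂ + e → t₁ + t₂ + a ≤ c₁ + c₂ + e
amortised-++ c₁ c₂ {t₁} {t₂} {a} {b} {e} first second = begin
  t₁ + t₂ + a   ≡⟨ swap₂₃ t₁ t₂ a ⟩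
  t₁ + a + t₂   ≤⟨ +-monoˡ-≤ t₂ first ⟩
  c₁ + b + t₂   ≡⟨ +-assoc-comm c₁ b t₂ ⟩
  c₁ + (t₂ + b) ≤⟨ +-monoʳ-≤ c₁ second ⟩
  c₁ + (c₂ + e) ≡⟨ sym (+-assoc c₁ c₂ e) ⟩
  c₁ + c₂ + e   ∎
  where
  open ≤-Reasoning
  swap₂₃ : ∀ x y z → x + y + z ≡ x + z + y
  swap₂₃ = solve-∀
  +-assoc-comm : ∀ x y z → x + y + z ≡ x + (z + y)
  +-assoc-comm = solve-∀

m∸o<n∸o⇒m<n : ∀ {m n o} → m ∸ o < n ∸ o → m < n
m∸o<n∸o⇒m<n {o = o} m∸o<n∸o = ≰⇒> λ n≤m → <⇒≱ m∸o<n∸o (∸-monoˡ-≤ o n≤m)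

m+[m∸1]≡2*m∸1 : ∀ m → m + (m ∸ 1) ≡ 2 * m ∸ 1
m+[m∸1]≡2*m∸1 zero    = refl
m+[m∸1]≡2*m∸1 (suc m) = 1+m+m≡m+[1+m+0] m
  where
  1+m+m≡m+[1+m+0] : ∀ m → suc m + m ≡ m + (suc m + 0)
  1+m+m≡m+[1+m+0] = solve-∀

m+[n∸1]≤2*n∸1 : ∀ {m n} → m ≤ n → m + (n ∸ 1) ≤ 2 * n ∸ 1
m+[n∸1]≤2*n∸1 {n = n} m≤n = ≤-trans (+-monoˡ-≤ (n ∸ 1) m≤n) (≤-reflexive (m+[m∸1]≡2*m∸1 n))

rIdx rMin rLast rKey rOne rOut rZero : Fin 7
rIdx  = zero
rMin  = suc zero
rLast = suc (suc zero)
rKey  = suc (suc (suc zero))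
rOne  = suc (suc (suc (suc zero)))
rOut  = suc (suc (suc (suc (suc zero))))
rZero = suc (suc (suc (suc (suc (suc zero)))))

-- Line k of the listing is address k; the jump targets are marked.  Addresses
-- 0–10 find δ (in rMin), 11–23 send every key of [δ, δ + n] to its home
-- position key − δ, and 24–37 move the elements at home to the front, the
-- next free front position being kept in rOut.
program : Vec (Instr 7) 38
program =
  const rOne 1 ∷
  lastIx rLast ∷
  key rMin rIdx ∷
  jlt rIdx rLast 5 ∷          -- 3
  jmp 11 ∷
  add rIdx rIdx rOne ∷        -- 5
  key rKey rIdx ∷
  jlt rKey rMin 9 ∷
  jmp 3 ∷
  add rMin rKey rZero ∷       -- 9
  jmp 3 ∷
  const rIdx 0 ∷              -- 11
  key rKey rIdx ∷             -- 12
  sub rKey rKey rMin ∷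
  jlt rLast rKey 20 ∷
  jlt rKey rIdx 18 ∷
  jlt rIdx rKey 18 ∷
  jmp 20 ∷
  swap rIdx rKey ∷            -- 18
  jmp 12 ∷
  jlt rIdx rLast 22 ∷         -- 20
  jmp 24 ∷
  add rIdx rIdx rOne ∷        -- 22
  jmp 12 ∷
  const rIdx 0 ∷              -- 24
  const rOut 0 ∷
  key rKey rIdx ∷             -- 26
  sub rKey rKey rMin ∷
  jlt rKey rIdx 34 ∷
  jlt rIdx rKey 34 ∷
  jlt rOut rIdx 32 ∷
  jmp 33 ∷
  swap rOut rIdx ∷            -- 32
  add rOut rOut rOne ∷        -- 33
  jlt rIdx rLast 36 ∷         -- 34
  halt ∷
  add rIdx rIdx rOne ∷        -- 36
  jmp 26 ∷
  []

module Execution (w : ℕ) {A : Set} (keyOf : A → ℕ) (n : ℕ) where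

  N : ℕ
  N = suc n

  Config : Set
  Config = State 7 A N

  W : ℕ
  W = 2 ^ w

  trunc′ : ℕ → ℕ
  trunc′ = trunc w program keyOf {N}

  -- When w = 0 the constant 1 is stored as 0, so rOne is only known to hold trunc′ 1.
  one : ℕ
  one = trunc′ 1

  registers : ℕ → ℕ → ℕ → ℕ → ℕ → Vec ℕ 7
  registers i m last k out = i ∷ m ∷ last ∷ k ∷ one ∷ out ∷ 0 ∷ []

  infixr 5 _▹_
  data Steps (σ : Config) : ℕ → Config → Set where
    done : Steps σ 0 σ
    _▹_  : ∀ {σ₁ σ₂ t} → step w program keyOf σ ≡ next σ₁ → Steps σ₁ t σ₂ → Steps σ (suc t) σ₂

  infixr 5 _++ˢ_
  _++ˢ_ : ∀ {σ₁ σ₂ σ₃ t u} → Steps σ₁ t σ₂ → Steps σ₂ u σ₃ → Steps σ₁ (t + u) σ₃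
  done     ++ˢ r′ = r′
  (e ▹ r) ++ˢ r′ = e ▹ (r ++ˢ r′)

  run-Steps : ∀ {σ σ′ t} → Steps σ t σ′ →
              ∀ u → run w program keyOf (t + u) σ ≡ run w program keyOf u σ′
  run-Steps done u = refl
  run-Steps {σ} (_▹_ {σ₁} e r) u with step w program keyOf σ | e
  ... | .(next σ₁) | refl = run-Steps r u

  run-halted : ∀ {σ : Config} → step w program keyOf σ ≡ halted σ →
               ∀ u → run w program keyOf u σ ≡ just σ
  run-halted {σ} e zero    with step w program keyOf σ | e
  ... | .(halted σ) | refl = refl
  run-halted {σ} e (suc u) with step w program keyOf σ | e
  ... | .(halted σ) | refl = refl

  trunc′-< : ∀ {x} → x < W → trunc′ x ≡ x
  trunc′-< = m<n⇒m%n≡m {{m^n≢0 2 w}}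

  trunc′-suc : ∀ {x} → suc x < W → trunc′ (x + one) ≡ suc x
  trunc′-suc {x} lt rewrite trunc′-< {1} (≤-<-trans (s≤s z≤n) lt) | +-comm x 1 = trunc′-< lt

  private
    exec′ : Instr 7 → Config → Outcome 7 A N
    exec′ = exec w program keyOf

  module _ {p : ℕ} {l : Vec A N} {s : ℕ} (rs : Vec ℕ 7) where

    jlt-taken : ∀ a b {t} → lookup rs a < lookup rs b → exec′ (jlt a b t) (st p rs l s) ≡ next (st t rs l s)
    jlt-taken a b lt with lookup rs a <? lookup rs b
    ... | yes _  = refl
    ... | no ¬lt = contradiction lt ¬lt

    jlt-not-taken : ∀ a b {t} → ¬ lookup rs a < lookup rs b →
                    exec′ (jlt a b t) (st p rs l s) ≡ next (st (suc p) rs l s)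
    jlt-not-taken a b ¬lt with lookup rs a <? lookup rs b
    ... | yes lt = contradiction lt ¬lt
    ... | no _   = refl

    key-ok : ∀ r a (i<N : lookup rs a < N) → keyOf (lookup l (fromℕ< i<N)) < W →
             exec′ (key r a) (st p rs l s) ≡ next (st (suc p) (rs [ r ]≔ keyOf (lookup l (fromℕ< i<N))) l s)
    key-ok r a i<N k<W with lookup rs a <? N
    ... | yes _  = cong (λ v → next (st (suc p) (rs [ r ]≔ v) l s)) (trunc′-< k<W)
    ... | no ¬lt = contradiction i<N ¬lt

    swap-ok : ∀ a b (i<N : lookup rs a < N) (j<N : lookup rs b < N) →
              exec′ (swap a b) (st p rs l s) ≡
              next (st (suc p) rs (swapElems l (fromℕ< i<N) (fromℕ< j<N)) (suc s))
    swap-ok a b i<N j<N with lookup rs a <? N | lookup rs b <? N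
    ... | yes _  | yes _  = refl
    ... | no ¬lt | _      = contradiction i<N ¬lt
    ... | yes _  | no ¬lt = contradiction j<N ¬lt

    inc-ok : ∀ r a b → lookup rs b ≡ one → suc (lookup rs a) < W →
             exec′ (add r a b) (st p rs l s) ≡ next (st (suc p) (rs [ r ]≔ suc (lookup rs a)) l s)
    inc-ok r a b b≡1 lt = cong (λ v → next (st (suc p) (rs [ r ]≔ v) l s))
      (trans (cong (λ z → trunc′ (lookup rs a + z)) b≡1) (trunc′-suc lt))

    mov-ok : ∀ r a b → lookup rs b ≡ 0 → lookup rs a < W →
             exec′ (add r a b) (st p rs l s) ≡ next (st (suc p) (rs [ r ]≔ lookup rs a) l s)
    mov-ok r a b b≡0 lt = cong (λ v → next (st (suc p) (rs [ r ]≔ v) l s))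
      (trans (cong (λ z → trunc′ (lookup rs a + z)) b≡0)
             (trans (cong trunc′ (+-identityʳ (lookup rs a))) (trunc′-< lt)))

    sub-ok : ∀ r a b → lookup rs a < W →
             exec′ (sub r a b) (st p rs l s) ≡ next (st (suc p) (rs [ r ]≔ (lookup rs a ∸ lookup rs b)) l s)
    sub-ok r a b lt = cong (λ v → next (st (suc p) (rs [ r ]≔ v) l s))
      (trunc′-< (≤-<-trans (m∸n≤m (lookup rs a) (lookup rs b)) lt))

    lastIx-ok : ∀ r → n < W → exec′ (lastIx r) (st p rs l s) ≡ next (st (suc p) (rs [ r ]≔ n) l s)
    lastIx-ok r lt = cong (λ v → next (st (suc p) (rs [ r ]≔ v) l s)) (trunc′-< lt)

    const-ok : ∀ r c → c < W → exec′ (const r c) (st p rs l s) ≡ next (st (suc p) (rs [ r ]≔ c) l s)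
    const-ok r c lt = cong (λ v → next (st (suc p) (rs [ r ]≔ v) l s)) (trunc′-< lt)

module Correctness (w : ℕ) {A : Set} (keyOf : A → ℕ) (n : ℕ) (S : Vec A (suc n))
  (N≤W : suc n ≤ 2 ^ w) (key<W : ∀ i → keyOf (lookup S i) < 2 ^ w)
  (key-injective : ∀ i j → keyOf (lookup S i) ≡ keyOf (lookup S j) → i ≡ j) where

  open Execution w keyOf n

  n<W : n < W
  n<W = N≤W

  keyAt : Vec A N → Fin N → ℕ
  keyAt l q = keyOf (lookup l q)

  δ : ℕ
  δ = minKey keyOf S

  δ≤keyAt-S : ∀ q → δ ≤ keyAt S q
  δ≤keyAt-S q = subst (δ ≤_) (lookup-map q keyOf S) (foldr₁-⊓-≤ (map keyOf S) q)

  δ-attained : ∃ λ q → keyAt S q ≡ δ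
  δ-attained with foldr₁-⊓-sel (map keyOf S)
  ... | q , e = q , sym (trans e (lookup-map q keyOf S))

  i+1+d≡n⇒i<n : ∀ {i d} → i + suc d ≡ n → i < n
  i+1+d≡n⇒i<n {i} e = subst (i <_) e (m<m+n i (s≤s z≤n))

  i+d≡n⇒i<N : ∀ {i d} → i + d ≡ n → i < N
  i+d≡n⇒i<N {i} {d} e = s≤s (subst (i ≤_) e (m≤m+n i d))

  -- Finding δ

  LowerBound : ℕ → ℕ → Set
  LowerBound i m = ∀ q → toℕ q ≤ i → m ≤ keyAt S q

  PrefixMin : ℕ → ℕ → Set
  PrefixMin i m = LowerBound i m × ∃ λ q → keyAt S q ≡ m

  lowerBound-extend : ∀ {i m} → LowerBound i m → (i<N : suc i < N) → m ≤ keyAt S (fromℕ< i<N) →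
                      LowerBound (suc i) m
  lowerBound-extend lb i<N = extend-upTo i<N (λ q q<i → lb q (s≤s⁻¹ q<i))

  prefixMin-δ : ∀ {m} → PrefixMin n m → m ≡ δ
  prefixMin-δ (lb , q , kq≡m) = ≤-antisym
    (subst (_ ≤_) (proj₂ δ-attained) (lb (proj₁ δ-attained) (s≤s⁻¹ (toℕ<n _))))
    (subst (δ ≤_) kq≡m (δ≤keyAt-S q))

  -- In the named configurations below, k is whatever the scratch register rKey holds.
  minLoop : ℕ → ℕ → ℕ → Config
  minLoop i m k = st 3 (registers i m n k 0) S 0

  placeStart : ℕ → Config
  placeStart k = st 11 (registers n δ n k 0) S 0

  MinStep : ℕ → ℕ → ℕ → ℕ → Set
  MinStep i m k k′ =
    ∃₂ λ m′ t → Steps (minLoop i m k) t (minLoop (suc i) m′ k′) × PrefixMin (suc i) m′ × t ≤ 6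

  minLoop-step : ∀ {i m} k → (i<n : i < n) → PrefixMin i m → MinStep i m k (keyAt S (fromℕ< (s≤s i<n)))
  minLoop-step {i} {m} k i<n (lb , att) = compare (k′ <? m)
    where
    k′ : ℕ
    k′ = keyAt S (fromℕ< (s≤s i<n))
    R = registers (suc i) m n k′ 0
    load : Steps (minLoop i m k) 3 (st 7 R S 0)
    load = jlt-taken (registers i m n k 0) rIdx rLast i<n ▹
           inc-ok (registers i m n k 0) rIdx rIdx rOne refl (≤-<-trans i<n n<W) ▹
           key-ok (registers (suc i) m n k 0) rKey rIdx (s≤s i<n) (key<W _) ▹ done
    compare : Dec (k′ < m) → MinStep i m k k′
    compare (yes k′<m) = k′ , 6 ,
      load ++ˢ jlt-taken R rKey rMin k′<m ▹ mov-ok R rMin rKey rZero refl (key<W _) ▹ refl ▹ done ,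
      (lowerBound-extend (λ q q≤i → ≤-trans (<⇒≤ k′<m) (lb q q≤i)) (s≤s i<n) ≤-refl , _ , refl) , ≤-refl
    compare (no k′≮m) = m , 5 ,
      load ++ˢ jlt-not-taken R rKey rMin k′≮m ▹ refl ▹ done ,
      (lowerBound-extend lb (s≤s i<n) (≮⇒≥ k′≮m) , att) , n≤1+n 5

  findMin : ∀ d {i m} k → i + d ≡ n → PrefixMin i m →
    ∃₂ λ k′ t → Steps (minLoop i m k) t (placeStart k′) × t ≤ d * 6 + 2
  findMin zero {i} {m} k i+0≡n pm with trans (sym (+-identityʳ i)) i+0≡n
  ... | refl with prefixMin-δ pm
  ...   | refl = k , 2 , jlt-not-taken (registers n δ n k 0) rIdx rLast (n≮n n) ▹ refl ▹ done , ≤-refl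
  findMin (suc d) {i} k i+d≡n pm with minLoop-step k (i+1+d≡n⇒i<n i+d≡n) pm
  ... | m′ , t , steps , pm′ , t≤6 with findMin d _ (trans (sym (+-suc i d)) i+d≡n) pm′
  ...   | k′ , t′ , steps′ , t′≤ = k′ , t + t′ , steps ++ˢ steps′ , +-mono-≤ t≤6 t′≤

  prefixMin-0 : PrefixMin 0 (keyAt S zero)
  prefixMin-0 = extend-upTo (s≤s z≤n) (λ _ ()) ≤-refl , zero , refl

  initialise : Steps (initial w program keyOf S) 3 (minLoop 0 (keyAt S zero) 0)
  initialise = refl ▹ lastIx-ok (registers 0 0 0 0 0) rLast n<W ▹
               key-ok (registers 0 0 n 0 0) rMin rIdx (s≤s z≤n) (key<W zero) ▹ done

  -- Rearrangements of the input

  record Arrangement (l : Vec A N) : Set where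
    field
      π        : Permutation′ N
      lookup-π : ∀ q → lookup l q ≡ lookup S (π ⟨$⟩ʳ q)

  input-arrangement : Arrangement S
  input-arrangement = record { π = Perm.id ; lookup-π = λ _ → refl }

  swap-arrangement : ∀ {l} → Arrangement l → ∀ a b → Arrangement (swapElems l a b)
  swap-arrangement {l} arr a b = record
    { π        = Perm.transpose a b ∘ₚ π
    ; lookup-π = λ q → trans (lookup-swapElems l a b q) (lookup-π (PC.transpose a b q))
    }
    where open Arrangement arr

  InRange : A → Set
  InRange x = δ ≤ keyOf x × keyOf x ≤ δ + n

  inRange? : (x : A) → Dec (InRange x)
  inRange? x = (δ ≤? keyOf x) ×-dec (keyOf x ≤? δ + n)

  home : Vec A N → Fin N → ℕ
  home l q = keyAt l q ∸ δ

  module _ {l : Vec A N} (arr : Arrangement l) where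
    open Arrangement arr

    keyAt-π : ∀ q → keyAt l q ≡ keyAt S (π ⟨$⟩ʳ q)
    keyAt-π q = cong keyOf (lookup-π q)

    keyAt<W : ∀ q → keyAt l q < W
    keyAt<W q = subst (_< W) (sym (keyAt-π q)) (key<W _)

    δ≤keyAt : ∀ q → δ ≤ keyAt l q
    δ≤keyAt q = subst (δ ≤_) (sym (keyAt-π q)) (δ≤keyAt-S _)

    keyAt-injective : ∀ {q q′} → keyAt l q ≡ keyAt l q′ → q ≡ q′
    keyAt-injective {q} {q′} e = trans (sym (inverseˡ π)) (trans (cong (π ⟨$⟩ˡ_) π-eq) (inverseˡ π))
      where
      π-eq : π ⟨$⟩ʳ q ≡ π ⟨$⟩ʳ q′
      π-eq = key-injective _ _ (trans (sym (keyAt-π q)) (trans e (keyAt-π q′)))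

    home-injective : ∀ {q q′} → home l q ≡ home l q′ → q ≡ q′
    home-injective {q} {q′} e = keyAt-injective (∸-cancelʳ-≡ (δ≤keyAt q) (δ≤keyAt q′) e)

    δ-occurs : ∃ λ q → home l q ≡ 0
    δ-occurs with δ-attained
    ... | q₀ , kq₀≡δ = π ⟨$⟩ˡ q₀ , trans (cong (_∸ δ) key≡δ) (n∸n≡0 δ)
      where
      key≡δ : keyAt l (π ⟨$⟩ˡ q₀) ≡ δ
      key≡δ = trans (keyAt-π _) (trans (cong (keyAt S) (inverseʳ π)) kq₀≡δ)

    count-inRange : count inRange? l ≡ nd keyOf S
    count-inRange = count-permute inRange? l S π lookup-π

  -- Sending every key home

  Settled : Vec A N → Fin N → Set
  Settled l q = home l q ≡ toℕ q ⊎ n < home l q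

  atHome : Vec A N → Subset N
  atHome l = tabulate (does ∘ λ q → home l q ≟ toℕ q)

  ∈-atHome⁺ : ∀ l {q} → home l q ≡ toℕ q → q ∈ atHome l
  ∈-atHome⁺ l = ∈-tabulate⁺ (λ q → home l q ≟ toℕ q)

  ∈-atHome⁻ : ∀ l {q} → q ∈ atHome l → home l q ≡ toℕ q
  ∈-atHome⁻ l = ∈-tabulate⁻ (λ q → home l q ≟ toℕ q)

  module Displace {l : Vec A N} (arr : Arrangement l) (I H : Fin N)
                  (home-I : home l I ≡ toℕ H) (I-away : home l I ≢ toℕ I) where

    H-away : home l H ≢ toℕ H
    H-away e = I-away (subst (λ z → home l I ≡ toℕ z) H≡I home-I)
      where
      H≡I : H ≡ I
      H≡I = home-injective arr (trans e (sym home-I))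

    H-home : home (swapElems l I H) H ≡ toℕ H
    H-home = trans (cong (λ x → keyOf x ∸ δ) (lookup-swapElems-ʳ l I H)) home-I

    home-other : ∀ {q} → q ≢ I → q ≢ H → home (swapElems l I H) q ≡ home l q
    home-other q≢I q≢H = cong (λ x → keyOf x ∸ δ) (lookup-swapElems-other l I H q≢I q≢H)

    atHome-⊂ : atHome l ⊂ atHome (swapElems l I H)
    atHome-⊂ = stays , H , ∈-atHome⁺ (swapElems l I H) H-home , H-away ∘ ∈-atHome⁻ l
      where
      stays : ∀ {q} → q ∈ atHome l → q ∈ atHome (swapElems l I H)
      stays q∈ with ∈-atHome⁻ l q∈
      ... | e = ∈-atHome⁺ (swapElems l I H)
                  (trans (home-other (λ { refl → I-away e }) (λ { refl → H-away e })) e)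

    settled-swap : ∀ {q} → q ≢ I → Settled l q → Settled (swapElems l I H) q
    settled-swap {q} q≢I q-settled with q Fin.≟ H
    ... | yes refl = inj₁ H-home
    ... | no q≢H   = subst (λ h → h ≡ toℕ q ⊎ n < h) (sym (home-other q≢I q≢H)) q-settled

  placeLoop : ℕ → ℕ → Vec A N → ℕ → Config
  placeLoop i k l s = st 12 (registers i δ n k 0) l s

  placeNext : ℕ → ℕ → Vec A N → ℕ → Config
  placeNext i k l s = st 20 (registers i δ n k 0) l s

  data PlaceStep {i} (i<N : i < N) (k : ℕ) (l : Vec A N) (s : ℕ) : Set where
    settled   : ∀ {t} → Steps (placeLoop i k l s) t (placeNext i (home l (fromℕ< i<N)) l s) → t ≤ 6 →
                Settled l (fromℕ< i<N) → PlaceStep i<N k l s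
    displaced : ∀ {t} H → let I = fromℕ< i<N in
                Steps (placeLoop i k l s) t (placeLoop i (home l I) (swapElems l I H) (suc s)) → t ≤ 7 →
                home l I ≡ toℕ H → home l I ≢ toℕ I → PlaceStep i<N k l s

  placeStep : ∀ {i} (i<N : i < N) k {l s} → Arrangement l → PlaceStep i<N k l s
  placeStep {i} i<N k {l} {s} arr = compareLast (n <? h)
    where
    I = fromℕ< i<N
    h = home l I
    R = registers i δ n h 0
    load : Steps (placeLoop i k l s) 2 (st 14 R l s)
    load = key-ok (registers i δ n k 0) rKey rIdx i<N (keyAt<W arr I) ▹
           sub-ok (registers i δ n (keyAt l I) 0) rKey rKey rMin (keyAt<W arr I) ▹ done
    h≢I : h ≢ i → h ≢ toℕ I
    h≢I h≢i e = h≢i (trans e (toℕ-fromℕ< i<N))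
    compareIdx : (h<N : h < N) → ¬ n < h → ¬ h < i → Dec (i < h) → PlaceStep i<N k l s
    compareIdx h<N n≮h h≮i (yes i<h) = displaced (fromℕ< h<N)
      (load ++ˢ jlt-not-taken R rLast rKey n≮h ▹ jlt-not-taken R rKey rIdx h≮i ▹ jlt-taken R rIdx rKey i<h ▹
       swap-ok R rIdx rKey i<N h<N ▹ refl ▹ done)
      ≤-refl (sym (toℕ-fromℕ< h<N)) (h≢I λ h≡i → <-irrefl (sym h≡i) i<h)
    compareIdx h<N n≮h h≮i (no i≮h) = settled
      (load ++ˢ jlt-not-taken R rLast rKey n≮h ▹ jlt-not-taken R rKey rIdx h≮i ▹ jlt-not-taken R rIdx rKey i≮h ▹
       refl ▹ done)
      ≤-refl (inj₁ (trans (≤-antisym (≮⇒≥ i≮h) (≮⇒≥ h≮i)) (sym (toℕ-fromℕ< i<N))))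
    compareHome : ¬ n < h → Dec (h < i) → PlaceStep i<N k l s
    compareHome n≮h (yes h<i) = displaced (fromℕ< h<N)
      (load ++ˢ jlt-not-taken R rLast rKey n≮h ▹ jlt-taken R rKey rIdx h<i ▹
       swap-ok R rIdx rKey i<N h<N ▹ refl ▹ done)
      (n≤1+n 6) (sym (toℕ-fromℕ< h<N)) (h≢I λ h≡i → <-irrefl h≡i h<i)
      where
      h<N : h < N
      h<N = s≤s (≮⇒≥ n≮h)
    compareHome n≮h (no h≮i) = compareIdx (s≤s (≮⇒≥ n≮h)) n≮h h≮i (i <? h)
    compareLast : Dec (n < h) → PlaceStep i<N k l s
    compareLast (yes n<h) = settled (load ++ˢ jlt-taken R rLast rKey n<h ▹ done) (m≤m+n 3 3) (inj₂ n<h)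
    compareLast (no n≮h)  = compareHome n≮h (h <? i)

  record Placed {i} (i<N : i < N) (k : ℕ) (l : Vec A N) (s : ℕ) : Set where
    constructor placed
    field
      {key′ swaps′ time} : ℕ
      {list′}            : Vec A N
      steps              : Steps (placeLoop i k l s) time (placeNext i key′ list′ swaps′)
      arrangement        : Arrangement list′
      swaps≤atHome       : swaps′ ≤ ∣ atHome list′ ∣
      settled≤i          : ∀ q → toℕ q ≤ i → Settled list′ q
      -- Each displacement takes at most 7 steps and is paid for by its swap.
      time≤              : time + s * 7 ≤ 6 + swaps′ * 7

  placeLoop-run : ∀ fuel {i} (i<N : i < N) k {l s} → N ≤ ∣ atHome l ∣ + fuel → Arrangement l →
                  s ≤ ∣ atHome l ∣ → (∀ q → toℕ q < i → Settled l q) → Placed i<N k l s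
  placeLoop-run fuel i<N k {l} {s} enough arr s≤ settled< with placeStep i<N k arr
  ... | settled steps t≤6 settledI =
        placed steps arr s≤ (extend-upTo i<N settled< settledI) (+-monoˡ-≤ (s * 7) t≤6)
  ... | displaced {t} H steps t≤7 home-I I-away = continue fuel enough
    where
    open Displace arr (fromℕ< i<N) H home-I I-away
    l′ : Vec A N
    l′ = swapElems l (fromℕ< i<N) H
    grows : ∣ atHome l ∣ < ∣ atHome l′ ∣
    grows = p⊂q⇒∣p∣<∣q∣ atHome-⊂
    continue : ∀ fuel → N ≤ ∣ atHome l ∣ + fuel → Placed i<N k l s
    continue zero enough =
      contradiction (≤-trans grows (≤-trans (∣p∣≤n (atHome l′)) (subst (N ≤_) (+-identityʳ _) enough)))
                    (<-irrefl refl)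
    continue (suc fuel) enough
      with placeLoop-run fuel i<N (home l (fromℕ< i<N))
             (≤-trans enough (≤-trans (≤-reflexive (+-suc _ fuel)) (+-monoˡ-≤ fuel grows)))
             (swap-arrangement arr (fromℕ< i<N) H) (≤-trans (s≤s s≤) grows)
             (λ q q<i → settled-swap (λ { refl → <-irrefl (toℕ-fromℕ< i<N) q<i }) (settled< q q<i))
    ... | placed steps′ arr′ s′≤ settled′ time′ =
          placed (steps ++ˢ steps′) arr′ s′≤ settled′
                 (amortised-++ 0 6 {t₁ = t} {a = s * 7} (+-monoˡ-≤ (s * 7) t≤7) time′)

  compactStart : ℕ → Vec A N → ℕ → Config
  compactStart k l s = st 24 (registers n δ n k 0) l s

  record PlacedAll (d i k : ℕ) (l : Vec A N) (s : ℕ) : Set where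
    constructor placedAll
    field
      {key′ swaps′ time} : ℕ
      {list′}            : Vec A N
      steps              : Steps (placeLoop i k l s) time (compactStart key′ list′ swaps′)
      arrangement        : Arrangement list′
      swaps≤atHome       : swaps′ ≤ ∣ atHome list′ ∣
      allSettled         : ∀ q → Settled list′ q
      time≤              : time + s * 7 ≤ suc d * 9 + swaps′ * 7

  placeAll : ∀ d {i} k {l s} → i + d ≡ n → Arrangement l → s ≤ ∣ atHome l ∣ →
             (∀ q → toℕ q < i → Settled l q) → PlacedAll d i k l s
  placeAll d k i+d≡n arr s≤ settled<
    with placeLoop-run N (i+d≡n⇒i<N i+d≡n) k (m≤n+m N _) arr s≤ settled<
  placeAll zero {i} k {s = s} i+0≡n _ _ _ | placed {k′} {time = t} steps arr′ s′≤ settled′ time′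
    with trans (sym (+-identityʳ i)) i+0≡n
  ... | refl = placedAll (steps ++ˢ jlt-not-taken (registers n δ n k′ 0) rIdx rLast (n≮n n) ▹ refl ▹ done)
                 arr′ s′≤ (λ q → settled′ q (s≤s⁻¹ (toℕ<n q)))
                 (≤-trans (amortised-++ 6 2 {t₁ = t} {a = s * 7} time′ ≤-refl) (+-monoˡ-≤ _ (n≤1+n 8)))
  placeAll (suc d) {i} k {s = s} i+d≡n _ _ _ | placed {k′} {time = t} steps arr′ s′≤ settled′ time′
    with placeAll d k′ (trans (sym (+-suc i d)) i+d≡n) arr′ s′≤ (λ q q<i → settled′ q (s≤s⁻¹ q<i))
  ... | placedAll steps′ arr″ s″≤ settled″ time″ =
        placedAll (steps ++ˢ jlt-taken R rIdx rLast i<n ▹ inc-ok R rIdx rIdx rOne refl (≤-<-trans i<n n<W) ▹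
                   refl ▹ steps′)
          arr″ s″≤ settled″
          (amortised-++ 6 (3 + suc d * 9) {t₁ = t} {a = s * 7} time′ (s≤s (s≤s (s≤s time″))))
    where
    i<n : i < n
    i<n = i+1+d≡n⇒i<n i+d≡n
    R = registers i δ n k′ 0

  -- Compaction

  record Compacted (j p : ℕ) (l : Vec A N) : Set where
    field
      prefix<j   : ∀ q → toℕ q < p → home l q < j
      sorted     : ∀ q q′ → toℕ q < toℕ q′ → toℕ q′ < p → keyAt l q < keyAt l q′
      gap-far    : ∀ q → p ≤ toℕ q → toℕ q < j → n < home l q
      settled≥j  : ∀ q → j ≤ toℕ q → Settled l q
      p≤j        : p ≤ j
      started    : 0 < j → 0 < p

  compacted-start : ∀ {l} → (∀ q → Settled l q) → Compacted 0 0 l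
  compacted-start all-settled = record
    { prefix<j  = λ _ ()
    ; sorted    = λ _ _ _ ()
    ; gap-far   = λ _ _ ()
    ; settled≥j = λ q _ → all-settled q
    ; p≤j       = z≤n
    ; started   = λ ()
    }

  home-zero : ∀ {l} → Arrangement l → (∀ q → Settled l q) → home l zero ≡ 0
  home-zero {l} arr all-settled with δ-occurs arr
  ... | q , hq≡0 with all-settled q
  ...   | inj₂ n<hq = contradiction (subst (n <_) hq≡0 n<hq) n≮0
  ...   | inj₁ hq≡q = subst (λ z → home l z ≡ 0) (toℕ-injective {j = zero} (trans (sym hq≡q) hq≡0)) hq≡0

  module _ {j p l} (c : Compacted j p l) (j<N : j < N) where
    open Compacted c
    private
      J : Fin N
      J = fromℕ< j<N
      toℕJ : toℕ J ≡ j
      toℕJ = toℕ-fromℕ< j<N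
      at-j : ∀ {q} → toℕ q ≡ j → q ≡ J
      at-j e = toℕ-injective (trans e (sym toℕJ))

    compacted-skip : Arrangement l → home l J ≢ j → Compacted (suc j) p l
    compacted-skip arr hJ≢j = record
      { prefix<j  = λ q q<p → m≤n⇒m≤1+n (prefix<j q q<p)
      ; sorted    = sorted
      ; gap-far   = gap-far′
      ; settled≥j = λ q j<q → settled≥j q (<⇒≤ j<q)
      ; p≤j       = m≤n⇒m≤1+n p≤j
      ; started   = started′
      }
      where
      gap-far′ : ∀ q → p ≤ toℕ q → toℕ q < suc j → n < home l q
      gap-far′ q p≤q q<1+j with toℕ q ≟ j
      ... | no q≢j = gap-far q p≤q (≤∧≢⇒< (s≤s⁻¹ q<1+j) q≢j)
      ... | yes q≡j with settled≥j q (≤-reflexive (sym q≡j))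
      ...   | inj₂ far = far
      ...   | inj₁ hq≡q = contradiction (subst (λ z → home l z ≡ j) (at-j q≡j) (trans hq≡q q≡j)) hJ≢j
      started′ : 0 < suc j → 0 < p
      started′ _ with j ≟ 0
      ... | no j≢0 = started (n≢0⇒n>0 j≢0)
      ... | yes refl = contradiction (home-zero arr λ q → settled≥j q z≤n) hJ≢j

    compacted-keep : home l J ≡ j → p ≡ j → Compacted (suc j) (suc p) l
    compacted-keep hJ≡j refl = record
      { prefix<j  = prefix<j′
      ; sorted    = sorted′
      ; gap-far   = λ q p<q q<1+p → contradiction (s≤s⁻¹ q<1+p) (<⇒≱ p<q)
      ; settled≥j = λ q j<q → settled≥j q (<⇒≤ j<q)
      ; p≤j       = ≤-refl
      ; started   = λ _ → s≤s z≤n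
      }
      where
      prefix<j′ : ∀ q → toℕ q < suc j → home l q < suc j
      prefix<j′ q q<1+j with toℕ q ≟ j
      ... | yes q≡j = s≤s (≤-reflexive (trans (cong (home l) (at-j q≡j)) hJ≡j))
      ... | no q≢j  = m≤n⇒m≤1+n (prefix<j q (≤∧≢⇒< (s≤s⁻¹ q<1+j) q≢j))
      sorted′ : ∀ q q′ → toℕ q < toℕ q′ → toℕ q′ < suc j → keyAt l q < keyAt l q′
      sorted′ q q′ q<q′ q′<1+j with toℕ q′ ≟ j
      ... | no q′≢j  = sorted q q′ q<q′ (≤∧≢⇒< (s≤s⁻¹ q′<1+j) q′≢j)
      ... | yes q′≡j = m∸o<n∸o⇒m<n {o = δ}
                         (subst (home l q <_) (sym (trans (cong (home l) (at-j q′≡j)) hJ≡j))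
                                (prefix<j q (subst (toℕ q <_) q′≡j q<q′)))

    compacted-swap : home l J ≡ j → (p<j : p < j) →
                     Compacted (suc j) (suc p) (swapElems l (fromℕ< (<-trans p<j j<N)) J)
    compacted-swap hJ≡j p<j = record
      { prefix<j  = prefix<j′
      ; sorted    = sorted′
      ; gap-far   = gap-far′
      ; settled≥j = settled≥j′
      ; p≤j       = s≤s (<⇒≤ p<j)
      ; started   = λ _ → s≤s z≤n
      }
      where
      P : Fin N
      P = fromℕ< (<-trans p<j j<N)
      l′ : Vec A N
      l′ = swapElems l P J
      toℕP : toℕ P ≡ p
      toℕP = toℕ-fromℕ< (<-trans p<j j<N)
      at-p : ∀ {q} → toℕ q ≡ p → q ≡ P
      at-p e = toℕ-injective (trans e (sym toℕP))
      P≢J : P ≢ J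
      P≢J P≡J = <-irrefl (trans (sym toℕP) (trans (cong toℕ P≡J) toℕJ)) p<j
      at-P : ∀ {q} → toℕ q ≡ p → lookup l′ q ≡ lookup l J
      at-P q≡p = trans (cong (lookup l′) (at-p q≡p)) (lookup-swapElems-ˡ l P J P≢J)
      at-J : ∀ {q} → toℕ q ≡ j → lookup l′ q ≡ lookup l P
      at-J q≡j = trans (cong (lookup l′) (at-j q≡j)) (lookup-swapElems-ʳ l P J)
      unchanged : ∀ {q} → toℕ q ≢ p → toℕ q ≢ j → lookup l′ q ≡ lookup l q
      unchanged q≢p q≢j = lookup-swapElems-other l P J (λ { refl → q≢p toℕP }) (λ { refl → q≢j toℕJ })
      unchanged< : ∀ {q} → toℕ q < p → lookup l′ q ≡ lookup l q
      unchanged< q<p = unchanged (λ q≡p → <-irrefl q≡p q<p) (λ q≡j → <-irrefl q≡j (<-trans q<p p<j))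
      homeOf : A → ℕ
      homeOf x = keyOf x ∸ δ

      prefix<j′ : ∀ q → toℕ q < suc p → home l′ q < suc j
      prefix<j′ q q<1+p with toℕ q ≟ p
      ... | yes q≡p = s≤s (≤-reflexive (trans (cong homeOf (at-P q≡p)) hJ≡j))
      ... | no q≢p  = let q<p = ≤∧≢⇒< (s≤s⁻¹ q<1+p) q≢p in
                      m≤n⇒m≤1+n (subst (_< j) (sym (cong homeOf (unchanged< q<p))) (prefix<j q q<p))

      sorted′ : ∀ q q′ → toℕ q < toℕ q′ → toℕ q′ < suc p → keyAt l′ q < keyAt l′ q′
      sorted′ q q′ q<q′ q′<1+p with toℕ q′ ≟ p
      ... | yes q′≡p = let q<p = subst (toℕ q <_) q′≡p q<q′ in
            subst₂ _<_ (sym (cong keyOf (unchanged< q<p))) (sym (cong keyOf (at-P q′≡p)))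
              (m∸o<n∸o⇒m<n {o = δ} (subst (home l q <_) (sym hJ≡j) (prefix<j q q<p)))
      ... | no q′≢p  = let q′<p = ≤∧≢⇒< (s≤s⁻¹ q′<1+p) q′≢p in
            subst₂ _<_ (sym (cong keyOf (unchanged< (<-trans q<q′ q′<p))))
                       (sym (cong keyOf (unchanged< q′<p)))
                       (sorted q q′ q<q′ q′<p)

      gap-far′ : ∀ q → suc p ≤ toℕ q → toℕ q < suc j → n < home l′ q
      gap-far′ q p<q q<1+j with toℕ q ≟ j
      ... | yes q≡j = subst (n <_) (sym (cong homeOf (at-J q≡j)))
                        (gap-far P (≤-reflexive (sym toℕP)) (subst (_< j) (sym toℕP) p<j))
      ... | no q≢j  = subst (n <_) (sym (cong homeOf (unchanged (λ q≡p → <-irrefl (sym q≡p) p<q) q≢j)))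
                        (gap-far q (<⇒≤ p<q) (≤∧≢⇒< (s≤s⁻¹ q<1+j) q≢j))

      settled≥j′ : ∀ q → suc j ≤ toℕ q → Settled l′ q
      settled≥j′ q j<q = subst (λ x → homeOf x ≡ toℕ q ⊎ n < homeOf x)
        (sym (unchanged (λ q≡p → <-irrefl (sym q≡p) (<-trans p<j j<q)) (λ q≡j → <-irrefl (sym q≡j) j<q)))
        (settled≥j q (<⇒≤ j<q))

  compactLoop : ℕ → ℕ → ℕ → Vec A N → ℕ → Config
  compactLoop j k p l s = st 26 (registers j δ n k p) l s

  compactNext : ℕ → ℕ → ℕ → Vec A N → ℕ → Config
  compactNext j k v l s = st 34 (registers j δ n k v) l s

  module Compaction (budget : ℕ) where

    -- Only the first element found at home, δ at position 0, moves without a swap.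
    SwapBudget : ℕ → ℕ → Set
    SwapBudget s p = s ≤ budget + (p ∸ 1)

    record CompactStep (j k p : ℕ) (l : Vec A N) (s : ℕ) : Set where
      constructor compactStep
      field
        {key′ out′ p′ swaps′ time} : ℕ
        {list′}                    : Vec A N
        steps                      : Steps (compactLoop j k p l s) time (compactNext j key′ out′ list′ swaps′)
        -- The increment of rOut can only wrap around on the last iteration.
        out≡p′                     : j < n → out′ ≡ p′
        arrangement                : Arrangement list′
        invariant                  : Compacted (suc j) p′ list′
        budget′                    : SwapBudget swaps′ p′
        time≤                      : time ≤ 7

    compactStep-run : ∀ {j} (j<N : j < N) k {p l s} → Arrangement l → Compacted j p l → SwapBudget s p →
                      CompactStep j k p l s
    compactStep-run {j} j<N k {p} {l} {s} arr c sb = compareBelow (h <? j)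
      where
      J = fromℕ< j<N
      h = home l J
      R = registers j δ n h p
      load : Steps (compactLoop j k p l s) 2 (st 28 R l s)
      load = key-ok (registers j δ n k p) rKey rIdx j<N (keyAt<W arr J) ▹
             sub-ok (registers j δ n (keyAt l J) p) rKey rKey rMin (keyAt<W arr J) ▹ done
      compareOut : h ≡ j → ¬ h < j → ¬ j < h → Dec (p < j) → CompactStep j k p l s
      compareOut h≡j h≮j j≮h (yes p<j) = compactStep
        (load ++ˢ jlt-not-taken R rKey rIdx h≮j ▹ jlt-not-taken R rIdx rKey j≮h ▹ jlt-taken R rOut rIdx p<j ▹
         swap-ok R rOut rIdx (<-trans p<j j<N) j<N ▹
         inc-ok R rOut rOut rOne refl (≤-<-trans (≤-trans p<j (s≤s⁻¹ j<N)) n<W) ▹ done)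
        (λ _ → refl) (swap-arrangement arr _ J) (compacted-swap c j<N h≡j p<j) budget-swap ≤-refl
        where
        budget-swap : suc s ≤ budget + (suc p ∸ 1)
        budget-swap with Compacted.started c (≤-<-trans z≤n p<j)
        ... | s≤s {n = p-1} _ = ≤-trans (s≤s sb) (≤-reflexive (sym (+-suc budget p-1)))
      compareOut h≡j h≮j j≮h (no p≮j) = compactStep
        (load ++ˢ jlt-not-taken R rKey rIdx h≮j ▹ jlt-not-taken R rIdx rKey j≮h ▹ jlt-not-taken R rOut rIdx p≮j ▹
         refl ▹ refl ▹ done)
        (λ j<n → trunc′-suc (≤-<-trans (≤-trans (s≤s (Compacted.p≤j c)) j<n) n<W)) arr
        (compacted-keep c j<N h≡j p≡j) (≤-trans sb (+-monoʳ-≤ budget (m∸n≤m p 1))) ≤-refl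
        where
        p≡j : p ≡ j
        p≡j = ≤-antisym (Compacted.p≤j c) (≮⇒≥ p≮j)
      compareAbove : ¬ h < j → Dec (j < h) → CompactStep j k p l s
      compareAbove h≮j (yes j<h) = compactStep
        (load ++ˢ jlt-not-taken R rKey rIdx h≮j ▹ jlt-taken R rIdx rKey j<h ▹ done)
        (λ _ → refl) arr (compacted-skip c j<N arr λ h≡j → <-irrefl (sym h≡j) j<h) sb (m≤n+m 4 3)
      compareAbove h≮j (no j≮h) = compareOut (≤-antisym (≮⇒≥ j≮h) (≮⇒≥ h≮j)) h≮j j≮h (p <? j)
      compareBelow : Dec (h < j) → CompactStep j k p l s
      compareBelow (yes h<j) = compactStep (load ++ˢ jlt-taken R rKey rIdx h<j ▹ done)
        (λ _ → refl) arr (compacted-skip c j<N arr λ h≡j → <-irrefl h≡j h<j) sb (m≤n+m 3 4)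
      compareBelow (no h≮j) = compareAbove h≮j (j <? h)

    record Finished (σ : Config) (b : ℕ) : Set where
      constructor finished
      field
        {final}     : Config
        {time p}    : ℕ
        steps       : Steps σ time final
        halts       : step w program keyOf final ≡ halted final
        time≤       : time ≤ b
        arrangement : Arrangement (list final)
        invariant   : Compacted N p (list final)
        budget′     : SwapBudget (swaps final) p

    compactAll : ∀ d {j} k {p l s} → j + d ≡ n → Arrangement l → Compacted j p l → SwapBudget s p →
                 Finished (compactLoop j k p l s) (suc d * 10)
    compactAll d k j+d≡n arr c sb with compactStep-run (i+d≡n⇒i<N j+d≡n) k arr c sb
    compactAll zero {j} k j+0≡n _ _ _ | compactStep {k′} {v} steps _ arr′ c′ sb′ t≤7
      with trans (sym (+-identityʳ j)) j+0≡n
    ... | refl = finished (steps ++ˢ jlt-not-taken (registers n δ n k′ v) rIdx rLast (n≮n n) ▹ done)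
                   refl (≤-trans (+-monoˡ-≤ 1 t≤7) (m≤m+n 8 2)) arr′ c′ sb′
    compactAll (suc d) {j} k j+d≡n _ _ _ | compactStep {k′} {v} steps v≡p′ arr′ c′ sb′ t≤7
      with v≡p′ (i+1+d≡n⇒i<n j+d≡n)
    ... | refl with compactAll d k′ (trans (sym (+-suc j d)) j+d≡n) arr′ c′ sb′
    ...   | finished steps′ halts t′≤ arr″ c″ sb″ =
            finished (steps ++ˢ jlt-taken R rIdx rLast j<n ▹ inc-ok R rIdx rIdx rOne refl (≤-<-trans j<n n<W) ▹
                      refl ▹ steps′)
              halts (+-mono-≤ t≤7 (s≤s (s≤s (s≤s t′≤)))) arr″ c″ sb″
      where
      j<n : j < n
      j<n = i+1+d≡n⇒i<n j+d≡n
      R = registers j δ n k′ v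

  home≤n⇒inRange : ∀ {l} → Arrangement l → ∀ {q} → home l q ≤ n → InRange (lookup l q)
  home≤n⇒inRange {l} arr {q} h≤n = δ≤keyAt arr q , ≤-trans (m≤n+m∸n (keyAt l q) δ) (+-monoʳ-≤ δ h≤n)

  inRange⇒home≤n : ∀ {l q} → keyAt l q ≤ δ + n → home l q ≤ n
  inRange⇒home≤n k≤δ+n = ≤-trans (∸-monoˡ-≤ δ k≤δ+n) (≤-reflexive (m+n∸m≡n δ n))

  ∣atHome∣≤nd : ∀ {l} → Arrangement l → ∣ atHome l ∣ ≤ nd keyOf S
  ∣atHome∣≤nd {l} arr = begin
    ∣ atHome l ∣                               ≤⟨ p⊆q⇒∣p∣≤∣q∣ atHome⊆inRange ⟩
    ∣ tabulate (does ∘ inRange? ∘ lookup l) ∣  ≡⟨ ∣tabulate∣≡count inRange? l ⟩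
    count inRange? l                           ≡⟨ count-inRange arr ⟩
    nd keyOf S                                 ∎
    where
    open ≤-Reasoning
    atHome⊆inRange : atHome l ⊆ tabulate (does ∘ inRange? ∘ lookup l)
    atHome⊆inRange {q} q∈ = ∈-tabulate⁺ (inRange? ∘ lookup l)
      (home≤n⇒inRange arr (≤-trans (≤-reflexive (∈-atHome⁻ l q∈)) (s≤s⁻¹ (toℕ<n q))))

  compacted-nd : ∀ {p l} → Arrangement l → Compacted N p l → p ≡ nd keyOf S
  compacted-nd {p} {l} arr c =
    trans (sym (count-prefix inRange? l p p≤j outside inside)) (count-inRange arr)
    where
    open Compacted c
    outside : ∀ q → InRange (lookup l q) → toℕ q < p
    outside q (_ , k≤δ+n) = ≰⇒> λ p≤q → <⇒≱ (gap-far q p≤q (toℕ<n q)) (inRange⇒home≤n {l} k≤δ+n)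
    inside : ∀ q → toℕ q < p → InRange (lookup l q)
    inside q q<p = home≤n⇒inRange arr (s≤s⁻¹ (prefix<j q q<p))

  total-time : ∀ {t₀ t₁ t₂ s₁} → t₀ ≤ n * 6 + 2 → t₁ + 0 ≤ N * 9 + s₁ * 7 → s₁ ≤ N → t₂ ≤ N * 10 →
               3 + (t₀ + (1 + (t₁ + (2 + t₂)))) ≤ 34 * N
  total-time {t₀} {t₁} {t₂} {s₁} t₀≤ t₁≤ s₁≤N t₂≤ = begin
    3 + (t₀ + (1 + (t₁ + (2 + t₂))))
      ≤⟨ +-monoʳ-≤ 3 (+-mono-≤ t₀≤ (s≤s (+-mono-≤ t₁≤N*16 (s≤s (s≤s t₂≤))))) ⟩
    3 + (n * 6 + 2 + (1 + (N * 16 + (2 + N * 10))))  ≡⟨ expand n ⟩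
    34 + n * 32                                       ≤⟨ +-monoʳ-≤ 34 (*-monoʳ-≤ n (m≤m+n 32 2)) ⟩
    N * 34                                            ≡⟨ *-comm N 34 ⟩
    34 * N                                            ∎
    where
    open ≤-Reasoning
    t₁≤N*16 : t₁ ≤ N * 16
    t₁≤N*16 = begin
      t₁              ≤⟨ m≤m+n t₁ 0 ⟩
      t₁ + 0          ≤⟨ t₁≤ ⟩
      N * 9 + s₁ * 7  ≤⟨ +-monoʳ-≤ (N * 9) (*-monoˡ-≤ 7 s₁≤N) ⟩
      N * 9 + N * 7   ≡⟨ sym (*-distribˡ-+ N 9 7) ⟩
      N * 16          ∎
    expand : ∀ n → 3 + (n * 6 + 2 + (1 + (suc n * 16 + (2 + suc n * 10)))) ≡ 34 + n * 32
    expand = solve-∀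

  sorts : Σ Config λ σ →
      (run w program keyOf (34 * N) (initial w program keyOf S) ≡ just σ) ×
      (∀ (i : Fin N) → toℕ i < nd keyOf S → (δ ≤ keyAt (list σ) i) × (keyAt (list σ) i ≤ δ + n)) ×
      (∀ (i j : Fin N) → toℕ i < toℕ j → toℕ j < nd keyOf S → keyAt (list σ) i < keyAt (list σ) j) ×
      (swaps σ ≤ 2 * nd keyOf S ∸ 1)
  sorts with findMin n {0} {keyAt S zero} 0 refl prefixMin-0
  ... | k₁ , t₀ , steps₀ , t₀≤ with placeAll n {0} k₁ refl input-arrangement z≤n (λ _ ())
  ... | placedAll {k₂} {s₁} {t₁} {l₁} steps₁ arr₁ s₁≤ allSettled t₁≤
    with Compaction.compactAll s₁ n {0} k₂ {0} refl arr₁ (compacted-start allSettled) (m≤m+n s₁ 0)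
  ... | Compaction.finished {σ} {t₂} {p} steps₂ halts t₂≤ arr c budget =
        σ , runs ,
        (λ q q<nd → home≤n⇒inRange arr (s≤s⁻¹ (Compacted.prefix<j c q (<nd⇒<p q<nd)))) ,
        (λ q q′ q<q′ q′<nd → Compacted.sorted c q q′ q<q′ (<nd⇒<p q′<nd)) ,
        ≤-trans budget (subst (λ x → s₁ + (x ∸ 1) ≤ 2 * nd keyOf S ∸ 1) (sym p≡nd)
                              (m+[n∸1]≤2*n∸1 (≤-trans s₁≤ (∣atHome∣≤nd arr₁))))
    where
    0<W : 0 < W
    0<W = ≤-<-trans z≤n n<W
    T : ℕ
    T = 3 + (t₀ + (1 + (t₁ + (2 + t₂))))
    all : Steps (initial w program keyOf S) T σ
    all = initialise ++ˢ steps₀ ++ˢ const-ok (registers n δ n k₁ 0) rIdx 0 0<W ▹ steps₁ ++ˢ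
          const-ok (registers n δ n k₂ 0) rIdx 0 0<W ▹ const-ok (registers 0 δ n k₂ 0) rOut 0 0<W ▹ steps₂
    T≤ : T ≤ 34 * N
    T≤ = total-time t₀≤ t₁≤ (≤-trans s₁≤ (∣p∣≤n (atHome l₁))) t₂≤
    runs : run w program keyOf (34 * N) (initial w program keyOf S) ≡ just σ
    runs = trans (cong (λ u → run w program keyOf u (initial w program keyOf S)) (sym (m+[n∸m]≡n T≤)))
                 (trans (run-Steps all (34 * N ∸ T)) (run-halted halts (34 * N ∸ T)))
    p≡nd : p ≡ nd keyOf S
    p≡nd = compacted-nd arr c
    <nd⇒<p : ∀ {x} → x < nd keyOf S → x < p
    <nd⇒<p = subst (_ <_) (sym p≡nd)

lemma1 : Σ ℕ λ k → Σ ℕ λ m → Σ (Vec (Instr k) m) λ P → Σ ℕ λ c →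
    (w : ℕ) {A : Set} (keyOf : A → ℕ) (n : ℕ) (S : Vec A (suc n)) →
    suc n ≤ 2 ^ w →
    (∀ i → keyOf (lookup S i) < 2 ^ w) →
    (∀ i j → keyOf (lookup S i) ≡ keyOf (lookup S j) → i ≡ j) →
    Σ (State k A (suc n)) λ σ →
      (run w P keyOf (c * suc n) (initial w P keyOf S) ≡ just σ) ×
      (∀ (i : Fin (suc n)) → toℕ i < nd keyOf S →
        (minKey keyOf S ≤ keyOf (lookup (list σ) i)) ×
        (keyOf (lookup (list σ) i) ≤ minKey keyOf S + n)) ×
      (∀ (i j : Fin (suc n)) → toℕ i < toℕ j → toℕ j < nd keyOf S →
        keyOf (lookup (list σ) i) < keyOf (lookup (list σ) j)) ×
      (swaps σ ≤ 2 * nd keyOf S ∸ 1)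
lemma1 = 7 , 38 , program , 34 , λ w keyOf n S → Correctness.sorts w keyOf n S
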